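{- Let $R_{n,d}$ be a $d$-regular simple graph on $n$ vertices. Then $m(R_{n,d})=\frac{n}{d+1}$.
   Context: For a simple graph $G$ with adjacency matrix $A$, $\mathrm{SOL}(G)$ is the set of $x$ with $x\ge0$, $(A+I)x\ge\mathbf{e}$, $x^\top((A+I)x-\mathbf{e})=0$ ($I$ identity, $\mathbf{e}$ all-ones vector), and $m(G)=\min\{\mathbf{e}^\top x\mid x\in\mathrm{SOL}(G)\}$.
   Formalization: The vectors x in $\mathrm{SOL}(G)$, over which the minimum $m(G)$ is taken, have rational entries. -}

module Defs where

open import Data.Bool using (Bool; true; false; if_then_else_)
open import Data.Nat using (ℕ; suc)
open import Data.Fin using (Fin)
open import Data.List using (List; foldr; map; allFin)
open import Data.Product using (_×_; Σ)
open import Data.Integer using (+_)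
open import Data.Rational using (ℚ; 0ℚ; 1ℚ; _+_; _*_; _-_; _≤_; _/_)
open import Relation.Binary.PropositionalEquality using (_≡_)
open import Relation.Nullary using (¬_)

record SimpleGraph (n : ℕ) : Set where
  field
    adj       : Fin n → Fin n → Bool
    symmetric : ∀ i j → adj i j ≡ adj j i
    loopless  : ∀ i → adj i i ≡ false
open SimpleGraph public

sumℕ : ∀ {n} → (Fin n → ℕ) → ℕ
sumℕ {n} f = foldr Data.Nat._+_ 0 (map f (allFin n))

sumℚ : ∀ {n} → (Fin n → ℚ) → ℚ
sumℚ {n} f = foldr _+_ 0ℚ (map f (allFin n))

degree : ∀ {n} → SimpleGraph n → Fin n → ℕ
degree G i = sumℕ (λ j → if adj G i j then 1 else 0)

Regular : ∀ {n} → ℕ → SimpleGraph n → Set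
Regular d G = ∀ i → degree G i ≡ d

Aentry : ∀ {n} → SimpleGraph n → Fin n → Fin n → ℚ
Aentry G i j = if adj G i j then 1ℚ else 0ℚ

AIx : ∀ {n} → SimpleGraph n → (Fin n → ℚ) → Fin n → ℚ
AIx G x i = x i + sumℚ (λ j → Aentry G i j * x j)

SOL : ∀ {n} → SimpleGraph n → (Fin n → ℚ) → Set
SOL G x = (∀ i → 0ℚ ≤ x i)
        × (∀ i → 1ℚ ≤ AIx G x i)
        × (sumℚ (λ i → x i * (AIx G x i - 1ℚ)) ≡ 0ℚ)

total : ∀ {n} → (Fin n → ℚ) → ℚ
total x = sumℚ x

-- "m(G) = v": v is the minimum of eᵀx over SOL(G) (attained, and a lower bound)
IsMinSOL : ∀ {n} → SimpleGraph n → ℚ → Set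
IsMinSOL {n} G v = Σ (Fin n → ℚ) (λ x → SOL G x × total x ≡ v)
             × (∀ x → SOL G x → v ≤ total x)

ratio : ℕ → ℕ → ℚ
ratio n d = (+ n) / suc d

-- Summing the covering constraints ((A + I) x)ᵢ ≥ 1 over all vertices counts
-- each xⱼ once for itself and once for every neighbour, i.e. d + 1 times in a
-- d-regular graph; so (d + 1) eᵀx ≥ n for every x ∈ SOL(G), without using
-- nonnegativity or complementarity. The uniform vector e / (d + 1) satisfies
-- (A + I) x = e exactly, hence lies in SOL(G) and attains the bound.

module Submission where

open import Defs
open import Algebra.Bundles using (Monoid; Ring)
open import Data.Bool using (true; false; if_then_else_)
open import Data.Fin using (Fin; zero; suc)
open import Data.Integer as ℤ using (+_)
import Data.Integer.Properties as ℤ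
open import Data.List as List using (allFin)
open import Data.List.Properties using (map-tabulate)
open import Data.Nat as ℕ using (ℕ; zero; suc)
import Data.Nat.Properties as ℕ
open import Data.Product using (_,_)
open import Data.Rational using (ℚ; 0ℚ; 1ℚ; _+_; _*_; _-_; _≤_; toℚᵘ)
import Data.Rational.Properties as ℚ
open import Data.Rational.Unnormalised as ℚᵘ using (mkℚᵘ; *≡*) renaming (_≃_ to _≃ᵘ_)
import Data.Rational.Unnormalised.Properties as ℚᵘ
open import Function using (id; _∘_)
open import Relation.Binary.PropositionalEquality

import Algebra.Properties.Monoid.Sum ℕ.+-0-monoid as ∑ℕ
open import Algebra.Properties.Semiring.Sum (Ring.semiring ℚ.+-*-ring)
  using (sum; sum-cong-≗; sum-replicate-zero; ∑-distrib-+; ∑-comm; *-distribˡ-sum; *-distribʳ-sum)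

module _ {a ℓ} (M : Monoid a ℓ) where
  open Monoid M using (Carrier; _∙_; ε)
  open import Algebra.Properties.Monoid.Sum M using () renaming (sum to ∑)

  foldr-tabulate≡sum : ∀ {n} (f : Fin n → Carrier) → List.foldr _∙_ ε (List.tabulate f) ≡ ∑ f
  foldr-tabulate≡sum {zero}  f = refl
  foldr-tabulate≡sum {suc n} f = cong (f zero ∙_) (foldr-tabulate≡sum (f ∘ suc))

  foldr-map-allFin≡sum : ∀ {n} (f : Fin n → Carrier) → List.foldr _∙_ ε (List.map f (allFin n)) ≡ ∑ f
  foldr-map-allFin≡sum f = trans (cong (List.foldr _∙_ ε) (map-tabulate id f)) (foldr-tabulate≡sum f)

sumℚ≡sum : ∀ {n} (f : Fin n → ℚ) → sumℚ f ≡ sum f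
sumℚ≡sum = foldr-map-allFin≡sum ℚ.+-0-monoid

sumℕ≡sum : ∀ {n} (f : Fin n → ℕ) → sumℕ f ≡ ∑ℕ.sum f
sumℕ≡sum = foldr-map-allFin≡sum ℕ.+-0-monoid

fromℕ : ℕ → ℚ
fromℕ k = ratio k 0

-- Identities between normalised rationals are checked on unnormalised
-- representatives, where they become integer identities.
toℚᵘ-ratio : ∀ k d → toℚᵘ (ratio k d) ≃ᵘ mkℚᵘ (+ k) d
toℚᵘ-ratio k d = ℚ.toℚᵘ-fromℚᵘ (mkℚᵘ (+ k) d)

fromℕ-+ : ∀ a b → fromℕ (a ℕ.+ b) ≡ fromℕ a + fromℕ b
fromℕ-+ a b = ℚ.toℚᵘ-injective (begin
  toℚᵘ (fromℕ (a ℕ.+ b))              ≈⟨ toℚᵘ-ratio (a ℕ.+ b) 0 ⟩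
  mkℚᵘ (+ (a ℕ.+ b)) 0                ≈⟨ *≡* (cong (ℤ._* + 1) (trans (ℤ.pos-+ a b) (sym (cong₂ ℤ._+_ (ℤ.*-identityʳ (+ a)) (ℤ.*-identityʳ (+ b)))))) ⟩
  mkℚᵘ (+ a) 0 ℚᵘ.+ mkℚᵘ (+ b) 0       ≈⟨ ℚᵘ.+-cong (toℚᵘ-ratio a 0) (toℚᵘ-ratio b 0) ⟨
  toℚᵘ (fromℕ a) ℚᵘ.+ toℚᵘ (fromℕ b)   ≈⟨ ℚ.toℚᵘ-homo-+ (fromℕ a) (fromℕ b) ⟨
  toℚᵘ (fromℕ a + fromℕ b)             ∎)
  where open ℚᵘ.≃-Reasoning

fromℕ-suc-* : ∀ k x → fromℕ (suc k) * x ≡ x + fromℕ k * x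
fromℕ-suc-* k x = begin
  fromℕ (1 ℕ.+ k) * x          ≡⟨ cong (_* x) (fromℕ-+ 1 k) ⟩
  (1ℚ + fromℕ k) * x           ≡⟨ ℚ.*-distribʳ-+ x 1ℚ (fromℕ k) ⟩
  1ℚ * x + fromℕ k * x         ≡⟨ cong (_+ fromℕ k * x) (ℚ.*-identityˡ x) ⟩
  x + fromℕ k * x              ∎
  where open ≡-Reasoning

fromℕ*ratio : ∀ m d → fromℕ m * ratio 1 d ≡ ratio m d
fromℕ*ratio m d = ℚ.toℚᵘ-injective (begin
  toℚᵘ (fromℕ m * ratio 1 d)             ≈⟨ ℚ.toℚᵘ-homo-* (fromℕ m) (ratio 1 d) ⟩
  toℚᵘ (fromℕ m) ℚᵘ.* toℚᵘ (ratio 1 d)    ≈⟨ ℚᵘ.*-cong (toℚᵘ-ratio m 0) (toℚᵘ-ratio 1 d) ⟩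
  mkℚᵘ (+ m) 0 ℚᵘ.* mkℚᵘ (+ 1) d          ≈⟨ *≡* (cong₂ ℤ._*_ (ℤ.*-identityʳ (+ m)) (cong +_ (sym (ℕ.*-identityˡ (suc d))))) ⟩
  mkℚᵘ (+ m) d                            ≈⟨ toℚᵘ-ratio m d ⟨
  toℚᵘ (ratio m d)                        ∎)
  where open ℚᵘ.≃-Reasoning

fromℕ-suc*ratio≡1 : ∀ d → fromℕ (suc d) * ratio 1 d ≡ 1ℚ
fromℕ-suc*ratio≡1 d = trans (fromℕ*ratio (suc d) d) ratio-diagonal
  where
  ratio-diagonal : ratio (suc d) d ≡ 1ℚ
  ratio-diagonal = ℚ.toℚᵘ-injective (ℚᵘ.≃-trans (toℚᵘ-ratio (suc d) d) (*≡* (ℤ.*-comm (+ suc d) (+ 1))))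

ratio-nonNeg : ∀ k d → 0ℚ ≤ ratio k d
ratio-nonNeg k d = ℚ.nonNegative⁻¹ (ratio k d) {{ℚ.normalize-nonNeg k (suc d)}}

fromℕ-sum : ∀ {n} (f : Fin n → ℕ) → fromℕ (∑ℕ.sum f) ≡ sum (fromℕ ∘ f)
fromℕ-sum {zero}  f = refl
fromℕ-sum {suc n} f = trans (fromℕ-+ (f zero) (∑ℕ.sum (f ∘ suc))) (cong (_+_ (fromℕ (f zero))) (fromℕ-sum (f ∘ suc)))

sum-const : ∀ n x → sum {n} (λ _ → x) ≡ fromℕ n * x
sum-const zero    x = sym (ℚ.*-zeroˡ x)
sum-const (suc n) x = trans (cong (_+_ x) (sum-const n x)) (sym (fromℕ-suc-* n x))

sum-mono-≤ : ∀ {n} {f g : Fin n → ℚ} → (∀ i → f i ≤ g i) → sum f ≤ sum g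
sum-mono-≤ {zero}  f≤g = ℚ.≤-refl
sum-mono-≤ {suc n} f≤g = ℚ.+-mono-≤ (f≤g zero) (sum-mono-≤ (f≤g ∘ suc))

module _ {n} (G : SimpleGraph n) where

  Aentry-sym : ∀ i j → Aentry G i j ≡ Aentry G j i
  Aentry-sym i j = cong (λ b → if b then 1ℚ else 0ℚ) (symmetric G i j)

  sum-Aentry : ∀ i → sum (Aentry G i) ≡ fromℕ (degree G i)
  sum-Aentry i = begin
    sum (Aentry G i)                 ≡⟨ sum-cong-≗ (λ j → sym (fromℕ-indicator (adj G i j))) ⟩
    sum (fromℕ ∘ indicator)          ≡⟨ fromℕ-sum indicator ⟨
    fromℕ (∑ℕ.sum indicator)         ≡⟨ cong fromℕ (sumℕ≡sum indicator) ⟨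
    fromℕ (degree G i)               ∎
    where
    open ≡-Reasoning
    indicator : Fin n → ℕ
    indicator j = if adj G i j then 1 else 0
    fromℕ-indicator : ∀ b → fromℕ (if b then 1 else 0) ≡ (if b then 1ℚ else 0ℚ)
    fromℕ-indicator true  = refl
    fromℕ-indicator false = refl

  sum-AIx : ∀ x → sum (AIx G x) ≡ sum (λ j → fromℕ (suc (degree G j)) * x j)
  sum-AIx x = begin
    sum (AIx G x)                                          ≡⟨ sum-cong-≗ (λ i → cong (_+_ (x i)) (sumℚ≡sum (λ j → Aentry G i j * x j))) ⟩
    sum (λ i → x i + sum (λ j → Aentry G i j * x j))       ≡⟨ ∑-distrib-+ x _ ⟩
    sum x + sum (λ i → sum (λ j → Aentry G i j * x j))     ≡⟨ cong (_+_ (sum x)) (∑-comm (λ i j → Aentry G i j * x j)) ⟩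
    sum x + sum (λ j → sum (λ i → Aentry G i j * x j))     ≡⟨ cong (_+_ (sum x)) (sum-cong-≗ column) ⟩
    sum x + sum (λ j → fromℕ (degree G j) * x j)           ≡⟨ ∑-distrib-+ x _ ⟨
    sum (λ j → x j + fromℕ (degree G j) * x j)             ≡⟨ sum-cong-≗ (λ j → fromℕ-suc-* (degree G j) (x j)) ⟨
    sum (λ j → fromℕ (suc (degree G j)) * x j)             ∎
    where
    open ≡-Reasoning
    column : ∀ j → sum (λ i → Aentry G i j * x j) ≡ fromℕ (degree G j) * x j
    column j = begin
      sum (λ i → Aentry G i j * x j)   ≡⟨ *-distribʳ-sum (x j) (λ i → Aentry G i j) ⟨
      sum (λ i → Aentry G i j) * x j   ≡⟨ cong (_* x j) (sum-cong-≗ (λ i → Aentry-sym i j)) ⟩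
      sum (Aentry G j) * x j           ≡⟨ cong (_* x j) (sum-Aentry j) ⟩
      fromℕ (degree G j) * x j         ∎

  SOL-intro : ∀ {x} → (∀ i → 0ℚ ≤ x i) → (∀ i → AIx G x i ≡ 1ℚ) → SOL G x
  SOL-intro {x} x≥0 tight = x≥0 , (λ i → ℚ.≤-reflexive (sym (tight i))) , complementary
    where
    complementary : sumℚ (λ i → x i * (AIx G x i - 1ℚ)) ≡ 0ℚ
    complementary = begin
      sumℚ (λ i → x i * (AIx G x i - 1ℚ))   ≡⟨ sumℚ≡sum (λ i → x i * (AIx G x i - 1ℚ)) ⟩
      sum (λ i → x i * (AIx G x i - 1ℚ))    ≡⟨ sum-cong-≗ (λ i → cong (λ y → x i * (y - 1ℚ)) (tight i)) ⟩
      sum (λ i → x i * 0ℚ)                  ≡⟨ sum-cong-≗ (λ i → ℚ.*-zeroʳ (x i)) ⟩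
      sum (λ (_ : Fin n) → 0ℚ)              ≡⟨ sum-replicate-zero n ⟩
      0ℚ                                    ∎
      where open ≡-Reasoning

  module _ {d} (reg : Regular d G) where

    AIx-const : ∀ c i → AIx G (λ _ → c) i ≡ fromℕ (suc d) * c
    AIx-const c i = begin
      c + sumℚ (λ j → Aentry G i j * c)   ≡⟨ cong (_+_ c) (sumℚ≡sum (λ j → Aentry G i j * c)) ⟩
      c + sum (λ j → Aentry G i j * c)    ≡⟨ cong (_+_ c) (*-distribʳ-sum c (Aentry G i)) ⟨
      c + sum (Aentry G i) * c            ≡⟨ cong (λ s → c + s * c) (trans (sum-Aentry i) (cong fromℕ (reg i))) ⟩
      c + fromℕ d * c                     ≡⟨ fromℕ-suc-* d c ⟨
      fromℕ (suc d) * c                   ∎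
      where open ≡-Reasoning

    sum-AIx-regular : ∀ x → sum (AIx G x) ≡ fromℕ (suc d) * sum x
    sum-AIx-regular x = begin
      sum (AIx G x)                              ≡⟨ sum-AIx x ⟩
      sum (λ j → fromℕ (suc (degree G j)) * x j) ≡⟨ sum-cong-≗ (λ j → cong (λ k → fromℕ (suc k) * x j) (reg j)) ⟩
      sum (λ j → fromℕ (suc d) * x j)            ≡⟨ *-distribˡ-sum (fromℕ (suc d)) x ⟨
      fromℕ (suc d) * sum x                      ∎
      where open ≡-Reasoning

    ratio≤total : ∀ {x} → (∀ i → 1ℚ ≤ AIx G x i) → ratio n d ≤ total x
    ratio≤total {x} cover = begin
      ratio n d                          ≡⟨ fromℕ*ratio n d ⟨
      fromℕ n * c                        ≡⟨ cong (_* c) (trans (sum-const n 1ℚ) (ℚ.*-identityʳ (fromℕ n))) ⟨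
      sum (λ (_ : Fin n) → 1ℚ) * c       ≤⟨ ℚ.*-monoʳ-≤-nonNeg c {{ℚ.normalize-nonNeg 1 (suc d)}} (sum-mono-≤ cover) ⟩
      sum (AIx G x) * c                  ≡⟨ cong (_* c) (sum-AIx-regular x) ⟩
      (fromℕ (suc d) * sum x) * c        ≡⟨ cong (_* c) (ℚ.*-comm (fromℕ (suc d)) (sum x)) ⟩
      (sum x * fromℕ (suc d)) * c        ≡⟨ ℚ.*-assoc (sum x) (fromℕ (suc d)) c ⟩
      sum x * (fromℕ (suc d) * c)        ≡⟨ cong (sum x *_) (fromℕ-suc*ratio≡1 d) ⟩
      sum x * 1ℚ                         ≡⟨ ℚ.*-identityʳ (sum x) ⟩
      sum x                              ≡⟨ sumℚ≡sum x ⟨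
      total x                            ∎
      where
      open ℚ.≤-Reasoning
      c : ℚ
      c = ratio 1 d

lemma5 : (n d : ℕ) (G : SimpleGraph n) → Regular d G → IsMinSOL G (ratio n d)
lemma5 n d G reg = (uniform , uniform-SOL , total-uniform) , λ x (_ , cover , _) → ratio≤total G reg cover
  where
  uniform : Fin n → ℚ
  uniform _ = ratio 1 d
  uniform-SOL : SOL G uniform
  uniform-SOL = SOL-intro G (λ _ → ratio-nonNeg 1 d) (λ i → trans (AIx-const G reg (ratio 1 d) i) (fromℕ-suc*ratio≡1 d))
  total-uniform : total uniform ≡ ratio n d
  total-uniform = trans (sumℚ≡sum uniform) (trans (sum-const n (ratio 1 d)) (fromℕ*ratio n d))
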